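{- Let $G$ be a finite group. The order supergraph $\mathcal{S}(G)$ is dominatable if and only if there exists an element $x\in G$ with $o(x)=\exp(G)$. Moreover, such an $x$ is a dominating vertex of $\mathcal{S}(G)$.
   Context: For a finite group $G$ with identity $e$, the order supergraph $\mathcal{S}(G)$ is the simple undirected graph with vertex set $G$ in which distinct $x,y$ are adjacent if and only if $o(x)\mid o(y)$ or $o(y)\mid o(x)$, where $o(x)$ is the order of $x$. A dominating vertex of a graph is a vertex adjacent to all other vertices. $\mathcal{S}(G)$ is called dominatable if it has a dominating vertex other than $e$. $\exp(G)$ is the least common multiple of the orders of the elements of $G$. -}

module Defs where

open import Level using (Level; _⊔_) renaming (suc to lsuc)
open import Algebra.Bundles using (Group)
open import Data.Nat using (ℕ; zero; suc; _<_; _≤_)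
open import Data.Nat.Divisibility using (_∣_)
open import Data.Fin using (Fin)
open import Data.Product using (Σ; ∃; _×_; _,_)
open import Data.Sum using (_⊎_)
open import Relation.Nullary using (¬_)
open import Relation.Binary using (Decidable)

module _ {c ℓ : Level} (G : Group c ℓ) where
  open Group G

  pow : Carrier → ℕ → Carrier
  pow x zero    = ε
  pow x (suc k) = x ∙ pow x k

  -- Finiteness of G: an enumeration of all elements by some Fin n.
  -- Decidability of equality is included (automatic for a finite group
  -- classically; needed to reason constructively).
  record IsFinite : Set (c ⊔ ℓ) where
    field
      size      : ℕ
      enum      : Fin size → Carrier
      enum-surj : ∀ x → ∃ λ i → enum i ≈ x
      _≟_       : Decidable _≈_

  IsOrder : Carrier → ℕ → Set ℓ
  IsOrder x k = (0 < k) × (pow x k ≈ ε) × (∀ j → 0 < j → pow x j ≈ ε → k ≤ j)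

  IsCommonMultipleOfOrders : ℕ → Set (c ⊔ ℓ)
  IsCommonMultipleOfOrders m = ∀ x k → IsOrder x k → k ∣ m

  IsExponent : ℕ → Set (c ⊔ ℓ)
  IsExponent m = IsCommonMultipleOfOrders m
               × (∀ m′ → IsCommonMultipleOfOrders m′ → m ∣ m′)

  Adjacent : Carrier → Carrier → Set ℓ
  Adjacent x y = ¬ (x ≈ y) ×
    (∀ m n → IsOrder x m → IsOrder y n → (m ∣ n ⊎ n ∣ m))

  Dominating : Carrier → Set (c ⊔ ℓ)
  Dominating v = ∀ y → ¬ (y ≈ v) → Adjacent v y

  Dominatable : Set (c ⊔ ℓ)
  Dominatable = ∃ λ v → ¬ (v ≈ ε) × Dominating v

  Nontrivial : Set (c ⊔ ℓ)
  Nontrivial = ∃ λ x → ¬ (x ≈ ε)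

{-# OPTIONS --safe #-}
-- Let v ≠ e be a dominating vertex, of order k > 1. The set of element orders
-- is closed under divisors, and every element order is comparable with k.
-- Two element orders d, n that are multiples of k are then comparable: otherwise
-- d = u g and n = w g with g = gcd d n and coprime u, w > 1; a prime q ∣ w is an
-- element order, hence divides k = r q, and the element order r u (a divisor of d)
-- is comparable with k only if u ∣ q or q ∣ u, impossible for coprime u, w > 1.
-- Consequently a maximal element order is divisible by k and by every other
-- element order, so it is exp(G). Conversely an element of order exp(G) has an
-- order divisible by all others, hence dominates; if it is e, then exp(G) = 1
-- and any element ≠ e dominates.
module Submission where

open import Defs
open import Level using (Level; _⊔_)
open import Algebra.Bundles using (Group)
open import Data.Nat.Base
  using ( ℕ; zero; suc; _+_; _*_; _∸_; _<_; _≤_; z<s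
        ; NonZero; ≢-nonZero; >-nonZero; >-nonZero⁻¹; nonTrivial⇒≢1)
open import Data.Nat.Properties
  using ( _≟_; _<?_; *-comm; *-identityˡ; ≤-antisym; ≤-trans; ≤-reflexive; ≤∧≢⇒<; ≮⇒≥; ≤⇒≯; <⇒≤; <⇒≢; <-trans
        ; n<1+n; n≢0⇒n>0; m<n⇒n≢0; m*n≢0⇒m≢0; m*n≢0⇒n≢0; m∸n+n≡m; m<n⇒0<n∸m; anyUpTo?)
open import Data.Nat.Divisibility
open import Data.Nat.DivMod using (_%_; _/_; m≡m%n+[m/n]*n; m%n<n; m*n/n≡m)
open import Data.Nat.GCD using (gcd; gcd[m,n]∣m; gcd[m,n]∣n; gcd[m,n]≢0; gcd-greatest)
open import Data.Nat.Coprimality using (Coprime; coprime-/gcd)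
open import Data.Nat.Primality using (Prime; prime⇒irreducible; prime⇒nonTrivial)
open import Data.Nat.Primality.Factorisation using (factorise; PrimeFactorisation)
open import Data.Nat.ListAction using (product)
open import Data.Nat.Induction using (<-rec)
open import Data.Fin.Base using (Fin; toℕ)
open import Data.Fin.Properties using (pigeonhole)
open import Data.List.Base using ([]; _∷_; allFin)
open import Data.List.Extrema.Nat using (argmax; f[xs]≤f[argmax])
open import Data.List.Membership.Propositional.Properties using (∈-allFin)
open import Data.List.Relation.Unary.All as All using (All; _∷_)
open import Data.Product using (∃; ∃₂; _×_; _,_; proj₁; proj₂)
open import Data.Sum as Sum using (_⊎_; inj₁; inj₂)
open import Data.Empty using (⊥-elim)
open import Function.Base using (_∘_)
open import Function.Bundles using (_⇔_; mk⇔)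
open import Relation.Nullary using (¬_; Dec; yes; no; contradiction)
open import Relation.Nullary.Decidable using (_×-dec_)
open import Relation.Unary using (Pred; Decidable)
open import Relation.Binary.PropositionalEquality as ≡ using (_≡_; _≢_)

∃-prime-divisor : ∀ {n} → n ≢ 0 → n ≢ 1 → ∃ λ p → Prime p × p ∣ n
∃-prime-divisor {n} n≢0 n≢1 =
  search (PrimeFactorisation.factors F) (PrimeFactorisation.isFactorisation F)
         (PrimeFactorisation.factorsPrime F)
  where
  instance
    nonZero : NonZero n
    nonZero = ≢-nonZero n≢0
  F : PrimeFactorisation n
  F = factorise n
  search : ∀ ps → n ≡ product ps → All Prime ps → ∃ λ p → Prime p × p ∣ n
  search []       n≡1 _          = ⊥-elim (n≢1 n≡1)
  search (p ∷ ps) n≡p*ps (pp ∷ _) = p , pp , divides (product ps) (≡.trans n≡p*ps (*-comm p _))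

coprime-cofactors : ∀ {m n u w} .{{_ : NonZero (gcd m n)}} →
                    m ≡ u * gcd m n → n ≡ w * gcd m n → Coprime u w
coprime-cofactors {m} {n} m≡ug n≡wg =
  ≡.subst₂ Coprime (cancel m≡ug) (cancel n≡wg) (coprime-/gcd m n)
  where
  cancel : ∀ {a c} → a ≡ c * gcd m n → a / gcd m n ≡ c
  cancel {c = c} ≡.refl = m*n/n≡m c (gcd m n)

module ComparableWith {p} (D : Pred ℕ p)
  (D⇒0< : ∀ {d} → D d → 0 < d)
  (D-∣-closed : ∀ {d e} → e ∣ d → D d → D e)
  {k} (1<k : 1 < k) (comparable : ∀ {d} → D d → d ∣ k ⊎ k ∣ d) where

  prime∣k : ∀ {q} → Prime q → D q → q ∣ k
  prime∣k pq Dq with comparable Dq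
  ... | inj₁ q∣k = q∣k
  ... | inj₂ k∣q with prime⇒irreducible pq k∣q
  ...   | inj₁ k≡1 = ⊥-elim (<⇒≢ 1<k (≡.sym k≡1))
  ...   | inj₂ k≡q = ∣-reflexive (≡.sym k≡q)

  cofactor≡1 : ∀ {u w g q} → Coprime u w → k ∣ g → D (u * g) → D (w * g) →
    Prime q → q ∣ w → u ≡ 1
  cofactor≡1 {u} {g = g} {q} coprime k∣g Dug Dwg pq q∣w =
    from-factorisation (prime∣k pq (D-∣-closed (∣-trans q∣w (m∣m*n g)) Dwg))
    where
    q∤u : ¬ q ∣ u
    q∤u q∣u = nonTrivial⇒≢1 {{prime⇒nonTrivial pq}} (coprime (q∣u , q∣w))

    from-factorisation : q ∣ k → u ≡ 1
    from-factorisation (divides r k≡rq) = conclude (comparable Dru)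
      where
      instance
        r≢0 : NonZero r
        r≢0 = ≢-nonZero λ { ≡.refl → <⇒≢ (<-trans z<s 1<k) (≡.sym k≡rq) }
      r∣g : r ∣ g
      r∣g = ∣-trans (divides q (≡.trans k≡rq (*-comm r q))) k∣g
      Dru : D (r * u)
      Dru = D-∣-closed (≡.subst (r * u ∣_) (*-comm g u) (*-pres-∣ r∣g (∣-refl {u}))) Dug
      conclude : r * u ∣ k ⊎ k ∣ r * u → u ≡ 1
      conclude (inj₁ ru∣k) with prime⇒irreducible pq (*-cancelˡ-∣ r (≡.subst (r * u ∣_) k≡rq ru∣k))
      ... | inj₁ u≡1 = u≡1
      ... | inj₂ u≡q = ⊥-elim (q∤u (∣-reflexive (≡.sym u≡q)))
      conclude (inj₂ k∣ru) = ⊥-elim (q∤u (*-cancelˡ-∣ r (≡.subst (_∣ r * u) k≡rq k∣ru)))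

  coprime-cofactors-trivial : ∀ {u w g} → Coprime u w → k ∣ g →
    D (u * g) → D (w * g) → u ≡ 1 ⊎ w ≡ 1
  coprime-cofactors-trivial {w = w} coprime k∣g Dug Dwg with w ≟ 1
  ... | yes w≡1 = inj₂ w≡1
  ... | no w≢1 with ∃-prime-divisor w≢0 w≢1
    where
    w≢0 : w ≢ 0
    w≢0 ≡.refl = <⇒≢ (D⇒0< Dwg) ≡.refl
  ...   | q , pq , q∣w = inj₁ (cofactor≡1 coprime k∣g Dug Dwg pq q∣w)

  multiples-comparable : ∀ {m n} → D m → D n → k ∣ m → k ∣ n → m ∣ n ⊎ n ∣ m
  multiples-comparable {m} {n} Dm Dn k∣m k∣n
    with gcd[m,n]∣m m n | gcd[m,n]∣n m n
  ... | divides u m≡ug | divides w n≡wg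
    with coprime-cofactors-trivial {u} {w}
           (coprime-cofactors {{≢-nonZero (gcd[m,n]≢0 m n (inj₂ n≢0))}} m≡ug n≡wg)
           (gcd-greatest k∣m k∣n) (≡.subst D m≡ug Dm) (≡.subst D n≡wg Dn)
    where
    n≢0 : n ≢ 0
    n≢0 = m<n⇒n≢0 (D⇒0< Dn)
  ... | inj₁ ≡.refl = inj₁ (≡.subst (_∣ n) (≡.sym (≡.trans m≡ug (*-identityˡ _))) (gcd[m,n]∣n m n))
  ... | inj₂ ≡.refl = inj₂ (≡.subst (_∣ m) (≡.sym (≡.trans n≡wg (*-identityˡ _))) (gcd[m,n]∣m m n))

  module _ (Dk : D k) {n} (Dn : D n) (maximal : ∀ {d} → D d → d ≤ n) where

    multiple-of-maximum-∣ : ∀ {d} → D d → n ∣ d → d ∣ n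
    multiple-of-maximum-∣ Dd n∣d =
      ∣-reflexive (≤-antisym (maximal Dd) (∣⇒≤ {{>-nonZero (D⇒0< Dd)}} n∣d))

    k∣maximum : k ∣ n
    k∣maximum with comparable Dn
    ... | inj₁ n∣k = multiple-of-maximum-∣ Dk n∣k
    ... | inj₂ k∣n = k∣n

    ∣-maximum : ∀ {d} → D d → d ∣ n
    ∣-maximum Dd with comparable Dd
    ... | inj₁ d∣k = ∣-trans d∣k k∣maximum
    ... | inj₂ k∣d with multiples-comparable Dd Dn k∣d k∣maximum
    ...   | inj₁ d∣n = d∣n
    ...   | inj₂ n∣d = multiple-of-maximum-∣ Dd n∣d

Least : ∀ {p} → Pred ℕ p → Pred ℕ p
Least P m = P m × (∀ {j} → j < m → ¬ P j)

least-witness : ∀ {p} {P : Pred ℕ p} → Decidable P → ∀ {n} → P n → ∃ (Least P)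
least-witness {P = P} P? {n} = <-rec (λ n → P n → ∃ (Least P)) step n
  where
  step : ∀ n → (∀ {j} → j < n → P j → ∃ (Least P)) → P n → ∃ (Least P)
  step n smaller Pn with anyUpTo? P? n
  ... | yes (j , j<n , Pj) = smaller j<n Pj
  ... | no  ∄j            = n , Pn , λ j<n Pj → ∄j (_ , j<n , Pj)

module OrderTheory {c ℓ} (G : Group c ℓ) where
  open Group G
  open import Algebra.Properties.Monoid.Mult monoid using (×-congʳ; ×-homo-+; ×-assocˡ)
    renaming (_×_ to _·_)
  open import Algebra.Properties.Group G using (identityˡ-unique)
  open import Relation.Binary.Reasoning.Setoid setoid

  infixr 8 _^_
  _^_ : Carrier → ℕ → Carrier
  _^_ = pow G

  ^≡· : ∀ x n → x ^ n ≡ n · x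
  ^≡· x zero    = ≡.refl
  ^≡· x (suc n) = ≡.cong (x ∙_) (^≡· x n)

  ^-congˡ : ∀ {x y} n → x ≈ y → x ^ n ≈ y ^ n
  ^-congˡ {x} {y} n x≈y rewrite ^≡· x n | ^≡· y n = ×-congʳ n x≈y

  ^-homo-+ : ∀ x m n → x ^ (m + n) ≈ x ^ m ∙ x ^ n
  ^-homo-+ x m n rewrite ^≡· x (m + n) | ^≡· x m | ^≡· x n = ×-homo-+ x m n

  ^-assoc : ∀ x m n → (x ^ n) ^ m ≈ x ^ (m * n)
  ^-assoc x m n rewrite ^≡· (x ^ n) m | ^≡· x n | ^≡· x (m * n) = ×-assocˡ x m n

  ε^n≈ε : ∀ n → ε ^ n ≈ ε
  ε^n≈ε zero    = refl
  ε^n≈ε (suc n) = trans (identityˡ _) (ε^n≈ε n)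

  IsOrder-unique : ∀ {x m n} → IsOrder G x m → IsOrder G x n → m ≡ n
  IsOrder-unique (0<m , xᵐ≈ε , m-min) (0<n , xⁿ≈ε , n-min) =
    ≤-antisym (m-min _ 0<n xⁿ≈ε) (n-min _ 0<m xᵐ≈ε)

  IsOrder-resp-≈ : ∀ {x y n} → x ≈ y → IsOrder G x n → IsOrder G y n
  IsOrder-resp-≈ {n = n} x≈y (0<n , xⁿ≈ε , minimal) =
    0<n , trans (^-congˡ n (sym x≈y)) xⁿ≈ε ,
    λ j 0<j yʲ≈ε → minimal j 0<j (trans (^-congˡ j x≈y) yʲ≈ε)

  IsOrder-ε : IsOrder G ε 1
  IsOrder-ε = z<s , identityˡ ε , λ j 0<j _ → 0<j

  IsOrder-1⇒≈ε : ∀ {x} → IsOrder G x 1 → x ≈ ε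
  IsOrder-1⇒≈ε (_ , x¹≈ε , _) = trans (sym (identityʳ _)) x¹≈ε

  IsOrder⇒∣ : ∀ {x n m} → IsOrder G x n → x ^ m ≈ ε → n ∣ m
  IsOrder⇒∣ {x} {n} {m} (0<n , xⁿ≈ε , minimal) xᵐ≈ε = from-remainder (m % n ≟ 0)
    where
    instance
      nonZero : NonZero n
      nonZero = >-nonZero 0<n
    x^[m%n]≈ε : x ^ (m % n) ≈ ε
    x^[m%n]≈ε = begin
      x ^ (m % n)                          ≈⟨ identityʳ _ ⟨
      x ^ (m % n) ∙ ε                      ≈⟨ ∙-congˡ (ε^n≈ε (m / n)) ⟨
      x ^ (m % n) ∙ ε ^ (m / n)            ≈⟨ ∙-congˡ (^-congˡ (m / n) xⁿ≈ε) ⟨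
      x ^ (m % n) ∙ (x ^ n) ^ (m / n)      ≈⟨ ∙-congˡ (^-assoc x (m / n) n) ⟩
      x ^ (m % n) ∙ x ^ (m / n * n)        ≈⟨ ^-homo-+ x (m % n) (m / n * n) ⟨
      x ^ (m % n + m / n * n)              ≡⟨ ≡.cong (x ^_) (m≡m%n+[m/n]*n m n) ⟨
      x ^ m                                ≈⟨ xᵐ≈ε ⟩
      ε                                    ∎
    from-remainder : Dec (m % n ≡ 0) → n ∣ m
    from-remainder (yes m%n≡0) = m%n≡0⇒n∣m m n m%n≡0
    from-remainder (no m%n≢0) =
      contradiction (m%n<n m n) (≤⇒≯ (minimal _ (n≢0⇒n>0 m%n≢0) x^[m%n]≈ε))

  IsOrder-^ : ∀ {x m n} → IsOrder G x (m * n) → IsOrder G (x ^ n) m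
  IsOrder-^ {x} {m} {n} ord@(0<mn , xᵐⁿ≈ε , _) =
    >-nonZero⁻¹ m , trans (^-assoc x m n) xᵐⁿ≈ε ,
    λ j 0<j [xⁿ]ʲ≈ε → ∣⇒≤ {{>-nonZero 0<j}}
      (*-cancelʳ-∣ n (IsOrder⇒∣ ord (trans (sym (^-assoc x j n)) [xⁿ]ʲ≈ε)))
    where
    instance
      mn≢0 : NonZero (m * n)
      mn≢0 = >-nonZero 0<mn
      m≢0 : NonZero m
      m≢0 = m*n≢0⇒m≢0 m
      n≢0 : NonZero n
      n≢0 = m*n≢0⇒n≢0 m

  IsElementOrder : ℕ → Set (c ⊔ ℓ)
  IsElementOrder d = ∃ λ x → IsOrder G x d

  IsElementOrder-∣-closed : ∀ {d e} → e ∣ d → IsElementOrder d → IsElementOrder e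
  IsElementOrder-∣-closed {d} {e} (divides f d≡fe) (x , x-ord) =
    x ^ f , IsOrder-^ (≡.subst (IsOrder G x) (≡.trans d≡fe (*-comm f e)) x-ord)

  orders-∣⇒Dominating : ∀ {x} → (∀ {y m n} → IsOrder G y n → IsOrder G x m → n ∣ m) →
                        Dominating G x
  orders-∣⇒Dominating orders-∣ y y≉x =
    (λ x≈y → y≉x (sym x≈y)) , λ _ _ x-ord y-ord → inj₂ (orders-∣ y-ord x-ord)

  exponent-order⇒Dominating : ∀ {x m} → IsExponent G m → IsOrder G x m → Dominating G x
  exponent-order⇒Dominating (common , _) x-ord =
    orders-∣⇒Dominating λ y-ord x-ord′ →
      ≡.subst (_ ∣_) (IsOrder-unique x-ord x-ord′) (common _ _ y-ord)

  IsExponent-1⇒Dominating : ∀ {x} → IsExponent G 1 → Dominating G x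
  IsExponent-1⇒Dominating (common , _) =
    orders-∣⇒Dominating λ y-ord _ →
      ≡.subst (_∣ _) (≡.sym (∣1⇒≡1 (common _ _ y-ord))) (1∣ _)

  module _ (fin : IsFinite G) where
    open IsFinite fin renaming (_≟_ to _≈?_)

    index : Carrier → Fin size
    index x = proj₁ (enum-surj x)

    enum-index : ∀ x → enum (index x) ≈ x
    enum-index x = proj₂ (enum-surj x)

    ∃-^≈ε : ∀ x → ∃ λ n → 0 < n × x ^ n ≈ ε
    ∃-^≈ε x with pigeonhole (n<1+n size) (λ i → index (x ^ toℕ i))
    ... | i , j , i<j , same-index =
      toℕ j ∸ toℕ i , m<n⇒0<n∸m i<j , identityˡ-unique _ _ (begin
        x ^ (toℕ j ∸ toℕ i) ∙ x ^ toℕ i   ≈⟨ ^-homo-+ x (toℕ j ∸ toℕ i) (toℕ i) ⟨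
        x ^ (toℕ j ∸ toℕ i + toℕ i)       ≡⟨ ≡.cong (x ^_) (m∸n+n≡m (<⇒≤ i<j)) ⟩
        x ^ toℕ j                         ≈⟨ enum-index _ ⟨
        enum (index (x ^ toℕ j))          ≡⟨ ≡.cong enum same-index ⟨
        enum (index (x ^ toℕ i))          ≈⟨ enum-index _ ⟩
        x ^ toℕ i                         ∎)

    order : ∀ x → ∃ (IsOrder G x)
    order x with ∃-^≈ε x
    ... | _ , 0<n , xⁿ≈ε with least-witness (λ j → (0 <? j) ×-dec ((x ^ j) ≈? ε)) (0<n , xⁿ≈ε)
    ...   | m , (0<m , xᵐ≈ε) , below =
      m , 0<m , xᵐ≈ε , λ j 0<j xʲ≈ε → ≮⇒≥ (λ j<m → below j<m (0<j , xʲ≈ε))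

    ∃-maximal-order : ∃₂ λ y n → IsOrder G y n × (∀ {z d} → IsOrder G z d → d ≤ n)
    ∃-maximal-order = y , ord y , proj₂ (order y) , bounded
      where
      ord : Carrier → ℕ
      ord x = proj₁ (order x)
      y : Carrier
      y = enum (argmax (ord ∘ enum) (index ε) (allFin size))
      bounded : ∀ {z d} → IsOrder G z d → d ≤ ord y
      bounded {z} z-ord = ≤-trans
        (≤-reflexive (IsOrder-unique z-ord (IsOrder-resp-≈ (enum-index z) (proj₂ (order _)))))
        (All.lookup (f[xs]≤f[argmax] {f = ord ∘ enum} (index ε) (allFin size))
                    (∈-allFin (index z)))


    exponent-order⇒Dominatable : ∀ {x m} → Nontrivial G →
      IsExponent G m → IsOrder G x m → Dominatable G
    exponent-order⇒Dominatable {x} {m} (y , y≉ε) exp x-ord with x ≈? ε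
    ... | no x≉ε = x , x≉ε , exponent-order⇒Dominating exp x-ord
    ... | yes x≈ε = y , y≉ε , IsExponent-1⇒Dominating (≡.subst (IsExponent G) m≡1 exp)
      where
      m≡1 : m ≡ 1
      m≡1 = IsOrder-unique x-ord (IsOrder-resp-≈ (sym x≈ε) IsOrder-ε)

    maximal-order-IsExponent : ∀ {v k y n} → ¬ v ≈ ε → Dominating G v → IsOrder G v k →
      IsOrder G y n → (∀ {z d} → IsOrder G z d → d ≤ n) → IsExponent G n
    maximal-order-IsExponent {v} {k} {y} {n} v≉ε v-dom v-ord y-ord maximal =
      (λ z d z-ord → ∣-maximum (v , v-ord) (y , y-ord) (λ (_ , z-ord) → maximal z-ord) (z , z-ord)) ,
      (λ _ common → common y n y-ord)
      where
      1<k : 1 < k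
      1<k = ≤∧≢⇒< (proj₁ v-ord) λ 1≡k →
        v≉ε (IsOrder-1⇒≈ε (≡.subst (IsOrder G v) (≡.sym 1≡k) v-ord))
      comparable : ∀ {d} → IsElementOrder d → d ∣ k ⊎ k ∣ d
      comparable (z , z-ord) with z ≈? v
      ... | yes z≈v = inj₁ (∣-reflexive (IsOrder-unique (IsOrder-resp-≈ z≈v z-ord) v-ord))
      ... | no z≉v = Sum.swap (proj₂ (v-dom z z≉v) _ _ v-ord z-ord)
      open ComparableWith IsElementOrder (λ (_ , 0<d , _) → 0<d) IsElementOrder-∣-closed 1<k comparable

    Dominatable⇒exponent-order : Dominatable G →
      ∃₂ λ x m → IsExponent G m × IsOrder G x m
    Dominatable⇒exponent-order (v , v≉ε , v-dom) =
      let y , n , y-ord , maximal = ∃-maximal-order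
      in y , n , maximal-order-IsExponent v≉ε v-dom (proj₂ (order v)) y-ord maximal , y-ord

mainTheorem5 : {c ℓ : Level} (G : Group c ℓ) → IsFinite G →
    (Nontrivial G →
      (Dominatable G ⇔ (∃ λ x → ∃ λ m → IsExponent G m × IsOrder G x m)))
    × (∀ x m → IsExponent G m → IsOrder G x m → Dominating G x)
mainTheorem5 G fin =
  (λ nontrivial → mk⇔ (Dominatable⇒exponent-order fin)
    (λ (_ , _ , exp , x-ord) → exponent-order⇒Dominatable fin nontrivial exp x-ord)) ,
  λ _ _ → exponent-order⇒Dominating
  where open OrderTheory G
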